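{- Let $S(z,t)=z+\frac{zt}{1-t-T(z)^2}$ be the bivariate generating function of all Catalan--Stanley trees, with $T(z)=\frac{1-\sqrt{1-4z}}{2}$. Then \[ \frac{1}{1-t}\, S\Big(z,\frac{t}{1-t}T(z)^2\Big) = S(z,t). \]
   Context: A Catalan--Stanley tree is a rooted plane tree in which, for every child $c$ of the root, the leaf reached from $c$ by repeatedly moving to the rightmost child (the rightmost leaf of that branch) has odd distance to the root; the one-node tree is included. In $S(z,t)$, $t$ marks these rightmost leaves of the branches attached to the root and $z$ marks all other nodes. $T(z)$ is the generating function of rooted plane trees by number of nodes. -}

module Defs where

open import Data.Nat as ℕ using (ℕ; zero; suc)
open import Data.Nat.Combinatorics using (_C_)
open import Data.Integer using (ℤ; +_; 0ℤ; 1ℤ) renaming (_+_ to _+ℤ_; _*_ to _*ℤ_)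
open import Relation.Binary.PropositionalEquality using (_≡_)

-- Bivariate formal power series over ℤ in z and t:
-- f i j is the coefficient of z^i t^j.
PS : Set
PS = ℕ → ℕ → ℤ

sumTo : ℕ → (ℕ → ℤ) → ℤ
sumTo zero    f = f zero
sumTo (suc n) f = sumTo n f +ℤ f (suc n)

infixl 6 _⊕_
infixl 7 _⊛_

_⊕_ : PS → PS → PS
(f ⊕ g) i j = f i j +ℤ g i j

_⊛_ : PS → PS → PS
(f ⊛ g) i j = sumTo i λ a → sumTo j λ b → f a b *ℤ g (i ℕ.∸ a) (j ℕ.∸ b)

oneS : PS
oneS zero zero = 1ℤ
oneS _    _    = 0ℤ

zS : PS
zS (suc zero) zero = 1ℤ
zS _          _    = 0ℤ

tS : PS
tS zero (suc zero) = 1ℤ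
tS _    _          = 0ℤ

_^S_ : PS → ℕ → PS
h ^S zero  = oneS
h ^S suc k = h ⊛ (h ^S k)

-- 1/(1-h) = Σ_k h^k, for a series h with zero constant term
-- (then h^k has no monomials of total degree < k, so the coefficient of
-- z^i t^j only receives contributions from k ≤ i + j).
inv1m : PS → PS
inv1m h i j = sumTo (i ℕ.+ j) λ k → (h ^S k) i j

catalan : ℕ → ℕ
catalan n = ((2 ℕ.* n) C n) ℕ.∸ ((2 ℕ.* n) C suc n)

-- T(z) = (1 - sqrt(1-4z))/2 = Σ_{n≥1} C_{n-1} z^n : plane trees by nodes
TS : PS
TS (suc n) zero = + catalan n
TS _       _    = 0ℤ

-- S(z,u) = z + z u / (1 - u - T(z)^2), as a function of the series u
-- substituted for t.
SS : PS → PS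
SS u = zS ⊕ zS ⊛ u ⊛ inv1m (u ⊕ TS ⊛ TS)

_≈S_ : PS → PS → Set
f ≈S g = ∀ i j → f i j ≡ g i j

module Submission where

-- Write A = 1/(1-t), C = 1/(1-t-T²) and u = t·T²·A, so that
-- S(z,t) = z + z·t·C and the left-hand side is A·(z + z·u·B) with
-- B = 1/(1-u-T²).  Since 1-u-T² = (1-t-T²)/(1-t), the inverse B equals
-- (1-t)·C, and after multiplying both sides by 1-t the claim becomes the
-- polynomial identity z + z·t·T²·C = (1-t)(z + z·t·C), which holds because
-- (1-t-T²)·C = 1.  This reasoning is valid in every commutative ring in which
-- A, B, C satisfy the fixed-point equations  x = 1 + h·x  of 1/(1-h).

open import Defs
open import Data.Nat using (ℕ; zero; suc; _≤_; _<_; z≤n; s≤s; _∸_) renaming (_+_ to _+ℕ_)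
import Data.Nat.Properties as ℕP
open import Data.Integer using (ℤ; +_; 0ℤ; -_) renaming (_+_ to _+ℤ_; _*_ to _*ℤ_)
import Data.Integer.Properties as ℤP
open import Algebra.Bundles using (CommutativeRing; RawRing)
open import Algebra.Structures using (IsAbelianGroup)
open import Level using (0ℓ)
open import Algebra.Properties.CommutativeSemigroup ℤP.+-commutativeSemigroup using (interchange)
import Algebra.Construct.Pointwise as Pointwise
open import Algebra.Solver.Ring.AlmostCommutativeRing
  using (fromCommutativeRing; _-Raw-AlmostCommutative⟶_; Induced-equivalence)
import Algebra.Solver.Ring as RingSolver
open import Data.Maybe using (just; nothing)
open import Data.Product using (_,_)
open import Data.Sum using (inj₁; inj₂)
open import Function using (_∘_)
open import Relation.Binary.Definitions using (WeaklyDecidable)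
open import Relation.Binary.PropositionalEquality as ≡
  using (_≡_; cong; cong₂; module ≡-Reasoning)
import Relation.Binary.Reasoning.Setoid as SetoidReasoning
open import Relation.Nullary using (yes; no)

-- Part 1: the identity in an arbitrary commutative ring.

-- The ring solver normalises polynomials with integer coefficients, so the
-- identity is proved for a commutative ring R given with its map ℤ → R.
ℤ-rawRing : RawRing 0ℓ 0ℓ
ℤ-rawRing = CommutativeRing.rawRing ℤP.+-*-commutativeRing

module SubstitutionIdentity {c ℓ} (R : CommutativeRing c ℓ)
  (fromℤ : ℤ-rawRing -Raw-AlmostCommutative⟶ fromCommutativeRing R) where

  open CommutativeRing R
  open SetoidReasoning setoid

  private
    equalCoefficients? : WeaklyDecidable (Induced-equivalence fromℤ)
    equalCoefficients? m n with m ℤP.≟ n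
    ... | yes ≡.refl = just refl
    ... | no _       = nothing

  open RingSolver ℤ-rawRing (fromCommutativeRing R) fromℤ equalCoefficients?
    using (solve; _:=_; _:+_; _:*_; _:-_; con)
  open _-Raw-AlmostCommutative⟶_ fromℤ using (⟦_⟧; 1-homo)

  -- The image of the integer 1: the unit as it appears in solver constants.
  𝟙 : Carrier
  𝟙 = ⟦ + 1 ⟧

  fixedPoint⇒inverse : ∀ {h x} → x ≈ 1# + h * x → (𝟙 - h) * x ≈ 𝟙
  fixedPoint⇒inverse {h} {x} x≈1+hx = begin
    (𝟙 - h) * x           ≈⟨ solve 2 (λ h x → (con (+ 1) :- h) :* x := x :- h :* x) refl h x ⟩
    x - h * x             ≈⟨ +-congʳ (trans x≈1+hx (+-congʳ (sym 1-homo))) ⟩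
    (𝟙 + h * x) - h * x   ≈⟨ solve 2 (λ h x → (con (+ 1) :+ h :* x) :- h :* x := con (+ 1)) refl h x ⟩
    𝟙                     ∎

  cancel : ∀ {w e x y} → w * e ≈ 1# → e * x ≈ e * y → x ≈ y
  cancel {w} {e} {x} {y} we≈1 ex≈ey = begin
    x              ≈⟨ sym (*-identityˡ x) ⟩
    1# * x         ≈⟨ *-congʳ (sym we≈1) ⟩
    (w * e) * x    ≈⟨ *-assoc w e x ⟩
    w * (e * x)    ≈⟨ *-congˡ ex≈ey ⟩
    w * (e * y)    ≈⟨ sym (*-assoc w e y) ⟩
    (w * e) * y    ≈⟨ *-congʳ we≈1 ⟩
    1# * y         ≈⟨ *-identityˡ y ⟩
    y              ∎

  substitutionIdentity : ∀ {z t q A B C} →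
    A ≈ 1# + t * A → C ≈ 1# + (t + q) * C → B ≈ 1# + (t * q * A + q) * B →
    A * (z + z * (t * q * A) * B) ≈ z + z * t * C
  substitutionIdentity {z} {t} {q} {A} {B} {C} fixA fixC fixB =
    cancel (trans (*-comm A (𝟙 - t)) (trans invA 1-homo)) (trans scaledLeft (sym scaledRight))
    where
    invA : (𝟙 - t) * A ≈ 𝟙
    invA = fixedPoint⇒inverse fixA
    invC : (𝟙 - (t + q)) * C ≈ 𝟙
    invC = fixedPoint⇒inverse fixC
    invB : (𝟙 - (t * q * A + q)) * B ≈ 𝟙
    invB = fixedPoint⇒inverse fixB

    -- (1-t)·C is another inverse of 1-u-q, because 1-u-q = (1-t-q)·A.
    invD : (𝟙 - (t * q * A + q)) * ((𝟙 - t) * C) ≈ 𝟙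
    invD = begin
      (𝟙 - (t * q * A + q)) * ((𝟙 - t) * C)
        ≈⟨ solve 4 (λ t q A C → (con (+ 1) :- (t :* q :* A :+ q)) :* ((con (+ 1) :- t) :* C)
                 := ((con (+ 1) :- t) :- t :* q :* ((con (+ 1) :- t) :* A) :- q :* (con (+ 1) :- t)) :* C)
                 refl t q A C ⟩
      ((𝟙 - t) - t * q * ((𝟙 - t) * A) - q * (𝟙 - t)) * C
        ≈⟨ *-congʳ (+-congʳ (+-congˡ (-‿cong (*-congˡ invA)))) ⟩
      ((𝟙 - t) - t * q * 𝟙 - q * (𝟙 - t)) * C
        ≈⟨ *-congʳ (solve 2 (λ t q → (con (+ 1) :- t) :- t :* q :* con (+ 1) :- q :* (con (+ 1) :- t)
                 := con (+ 1) :- (t :+ q)) refl t q) ⟩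
      (𝟙 - (t + q)) * C
        ≈⟨ invC ⟩
      𝟙 ∎

    B≈D : B ≈ (𝟙 - t) * C
    B≈D = cancel (trans (*-comm B _) (trans invB 1-homo)) (trans invB (sym invD))

    scaledLeft : (𝟙 - t) * (A * (z + z * (t * q * A) * B)) ≈ z + z * t * q * C
    scaledLeft = begin
      (𝟙 - t) * (A * (z + z * (t * q * A) * B))
        ≈⟨ *-congˡ (*-congˡ (+-congˡ (*-congˡ B≈D))) ⟩
      (𝟙 - t) * (A * (z + z * (t * q * A) * ((𝟙 - t) * C)))
        ≈⟨ solve 5 (λ z t q A C → (con (+ 1) :- t) :* (A :* (z :+ z :* (t :* q :* A) :* ((con (+ 1) :- t) :* C)))
                 := ((con (+ 1) :- t) :* A) :* z :+ ((con (+ 1) :- t) :* A) :* ((con (+ 1) :- t) :* A) :* (z :* t :* q :* C))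
                 refl z t q A C ⟩
      ((𝟙 - t) * A) * z + ((𝟙 - t) * A) * ((𝟙 - t) * A) * (z * t * q * C)
        ≈⟨ +-cong (*-congʳ invA) (*-congʳ (*-cong invA invA)) ⟩
      𝟙 * z + 𝟙 * 𝟙 * (z * t * q * C)
        ≈⟨ solve 4 (λ z t q C → con (+ 1) :* z :+ con (+ 1) :* con (+ 1) :* (z :* t :* q :* C)
                 := z :+ z :* t :* q :* C) refl z t q C ⟩
      z + z * t * q * C ∎

    scaledRight : (𝟙 - t) * (z + z * t * C) ≈ z + z * t * q * C
    scaledRight = begin
      (𝟙 - t) * (z + z * t * C)
        ≈⟨ solve 4 (λ z t q C → (con (+ 1) :- t) :* (z :+ z :* t :* C)
                 := z :- z :* t :* (con (+ 1) :- (con (+ 1) :- (t :+ q)) :* C) :+ z :* t :* q :* C)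
                 refl z t q C ⟩
      z - z * t * (𝟙 - (𝟙 - (t + q)) * C) + z * t * q * C
        ≈⟨ +-congʳ (+-congˡ (-‿cong (*-congˡ (+-congˡ (-‿cong invC))))) ⟩
      z - z * t * (𝟙 - 𝟙) + z * t * q * C
        ≈⟨ solve 4 (λ z t q C → z :- z :* t :* (con (+ 1) :- con (+ 1)) :+ z :* t :* q :* C
                 := z :+ z :* t :* q :* C) refl z t q C ⟩
      z + z * t * q * C ∎

-- Part 2: bivariate power series over ℤ form a commutative ring.

sumTo-congᵇ : ∀ n {f g : ℕ → ℤ} → (∀ k → k ≤ n → f k ≡ g k) → sumTo n f ≡ sumTo n g
sumTo-congᵇ zero    f≡g = f≡g 0 z≤n
sumTo-congᵇ (suc n) f≡g =
  cong₂ _+ℤ_ (sumTo-congᵇ n (λ k k≤n → f≡g k (ℕP.m≤n⇒m≤1+n k≤n))) (f≡g (suc n) ℕP.≤-refl)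

sumTo-cong : ∀ n {f g : ℕ → ℤ} → (∀ k → f k ≡ g k) → sumTo n f ≡ sumTo n g
sumTo-cong n f≡g = sumTo-congᵇ n (λ k _ → f≡g k)

sumTo-+ : ∀ n (f g : ℕ → ℤ) → sumTo n (λ k → f k +ℤ g k) ≡ sumTo n f +ℤ sumTo n g
sumTo-+ zero    f g = ≡.refl
sumTo-+ (suc n) f g = ≡.trans (cong (_+ℤ (f (suc n) +ℤ g (suc n))) (sumTo-+ n f g))
                              (interchange (sumTo n f) (sumTo n g) (f (suc n)) (g (suc n)))

sumTo-*ˡ : ∀ n c (f : ℕ → ℤ) → c *ℤ sumTo n f ≡ sumTo n (λ k → c *ℤ f k)
sumTo-*ˡ zero    c f = ≡.refl
sumTo-*ˡ (suc n) c f = ≡.trans (ℤP.*-distribˡ-+ c (sumTo n f) (f (suc n)))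
                               (cong (_+ℤ (c *ℤ f (suc n))) (sumTo-*ˡ n c f))

sumTo-*ʳ : ∀ n c (f : ℕ → ℤ) → sumTo n f *ℤ c ≡ sumTo n (λ k → f k *ℤ c)
sumTo-*ʳ zero    c f = ≡.refl
sumTo-*ʳ (suc n) c f = ≡.trans (ℤP.*-distribʳ-+ c (sumTo n f) (f (suc n)))
                               (cong (_+ℤ (f (suc n) *ℤ c)) (sumTo-*ʳ n c f))

sumTo-shift : ∀ n (f : ℕ → ℤ) → sumTo (suc n) f ≡ f 0 +ℤ sumTo n (f ∘ suc)
sumTo-shift zero    f = ≡.refl
sumTo-shift (suc n) f = ≡.trans (cong (_+ℤ f (suc (suc n))) (sumTo-shift n f)) (ℤP.+-assoc (f 0) _ _)

sumTo-zero : ∀ n {f : ℕ → ℤ} → (∀ k → k ≤ n → f k ≡ 0ℤ) → sumTo n f ≡ 0ℤ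
sumTo-zero zero    f≡0 = f≡0 0 z≤n
sumTo-zero (suc n) f≡0 =
  cong₂ _+ℤ_ (sumTo-zero n (λ k k≤n → f≡0 k (ℕP.m≤n⇒m≤1+n k≤n))) (f≡0 (suc n) ℕP.≤-refl)

sumTo-head : ∀ n {f : ℕ → ℤ} → (∀ k → f (suc k) ≡ 0ℤ) → sumTo n f ≡ f 0
sumTo-head zero    f≡0 = ≡.refl
sumTo-head (suc n) {f} f≡0 = ≡.trans (sumTo-shift n f)
  (≡.trans (cong (f 0 +ℤ_) (sumTo-zero n (λ k _ → f≡0 k))) (ℤP.+-identityʳ (f 0)))

sumTo-swap : ∀ m n (F : ℕ → ℕ → ℤ) →
  sumTo m (λ a → sumTo n (λ b → F a b)) ≡ sumTo n (λ b → sumTo m (λ a → F a b))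
sumTo-swap zero    n F = ≡.refl
sumTo-swap (suc m) n F = ≡.trans (cong (_+ℤ sumTo n (F (suc m))) (sumTo-swap m n F))
                                 (≡.sym (sumTo-+ n (λ b → sumTo m (λ a → F a b)) (F (suc m))))

sumTo-extend : ∀ n N {f : ℕ → ℤ} → n ≤ N → (∀ k → n < k → k ≤ N → f k ≡ 0ℤ) → sumTo N f ≡ sumTo n f
sumTo-extend n zero    z≤n    f≡0 = ≡.refl
sumTo-extend n (suc N) n≤1+N f≡0 with ℕP.m≤n⇒m<n∨m≡n n≤1+N
... | inj₂ ≡.refl = ≡.refl
... | inj₁ (s≤s n≤N) = ≡.trans
  (cong₂ _+ℤ_ (sumTo-extend n N n≤N (λ k n<k k≤N → f≡0 k n<k (ℕP.m≤n⇒m≤1+n k≤N)))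
              (f≡0 (suc N) (s≤s n≤N) ℕP.≤-refl))
  (ℤP.+-identityʳ _)

sumTo-reverse : ∀ n (f : ℕ → ℤ) → sumTo n f ≡ sumTo n (λ k → f (n ∸ k))
sumTo-reverse zero    f = ≡.refl
sumTo-reverse (suc n) f = begin
  sumTo n f +ℤ f (suc n)                   ≡⟨ cong (_+ℤ f (suc n)) (sumTo-reverse n f) ⟩
  sumTo n (λ k → f (n ∸ k)) +ℤ f (suc n)   ≡⟨ ℤP.+-comm (sumTo n (λ k → f (n ∸ k))) (f (suc n)) ⟩
  f (suc n) +ℤ sumTo n (λ k → f (n ∸ k))   ≡⟨ ≡.sym (sumTo-shift n (λ k → f (suc n ∸ k))) ⟩
  sumTo (suc n) (λ k → f (suc n ∸ k))      ∎
  where open ≡-Reasoning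

conv : ℕ → (ℕ → ℕ → ℤ) → ℤ
conv n F = sumTo n (λ a → F a (n ∸ a))

conv-cong : ∀ n {F G : ℕ → ℕ → ℤ} → (∀ a a' → F a a' ≡ G a a') → conv n F ≡ conv n G
conv-cong n F≡G = sumTo-cong n (λ a → F≡G a _)

conv-+ : ∀ n F G → conv n (λ a a' → F a a' +ℤ G a a') ≡ conv n F +ℤ conv n G
conv-+ n F G = sumTo-+ n _ _

conv-comm : ∀ n F → conv n F ≡ conv n (λ a a' → F a' a)
conv-comm n F = ≡.trans (sumTo-reverse n _)
  (sumTo-congᵇ n (λ a a≤n → cong (F (n ∸ a)) (ℕP.m∸[m∸n]≡n a≤n)))

conv-suc : ∀ n F → conv (suc n) F ≡ conv n (λ a a' → F a (suc a')) +ℤ F (suc n) 0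
conv-suc n F = cong₂ _+ℤ_ (sumTo-congᵇ n (λ a a≤n → cong (F a) (ℕP.+-∸-assoc 1 a≤n)))
                          (cong (F (suc n)) (ℕP.n∸n≡0 n))

-- Both sides are the sum of φ c e k over all c + e + k = n.
conv-assoc : ∀ n (φ : ℕ → ℕ → ℕ → ℤ) →
  conv n (λ a k → conv a (λ c e → φ c e k)) ≡ conv n (λ c m → conv m (λ e k → φ c e k))
conv-assoc zero    φ = ≡.refl
conv-assoc (suc n) φ = begin
  conv (suc n) (λ a k → conv a (λ c e → φ c e k))
    ≡⟨ conv-suc n (λ a k → conv a (λ c e → φ c e k)) ⟩
  conv n (λ a k → conv a (λ c e → φ c e (suc k))) +ℤ conv (suc n) (λ c e → φ c e 0)
    ≡⟨ cong₂ _+ℤ_ (conv-assoc n (λ c e k → φ c e (suc k))) (conv-suc n (λ c e → φ c e 0)) ⟩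
  Σsuc +ℤ (conv n (λ c k → φ c (suc k) 0) +ℤ φ (suc n) 0 0)
    ≡⟨ ≡.sym (ℤP.+-assoc Σsuc (conv n (λ c k → φ c (suc k) 0)) (φ (suc n) 0 0)) ⟩
  (Σsuc +ℤ conv n (λ c k → φ c (suc k) 0)) +ℤ φ (suc n) 0 0
    ≡⟨ cong (_+ℤ φ (suc n) 0 0) (≡.sym (conv-+ n (λ c m → conv m (λ e k → φ c e (suc k))) (λ c k → φ c (suc k) 0))) ⟩
  conv n (λ c m → conv m (λ e k → φ c e (suc k)) +ℤ φ c (suc m) 0) +ℤ φ (suc n) 0 0
    ≡⟨ cong (_+ℤ φ (suc n) 0 0) (conv-cong n (λ c m → ≡.sym (conv-suc m (φ c)))) ⟩
  conv n (λ c m → conv (suc m) (λ e k → φ c e k)) +ℤ φ (suc n) 0 0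
    ≡⟨ ≡.sym (conv-suc n (λ c m → conv m (λ e k → φ c e k))) ⟩
  conv (suc n) (λ c m → conv m (λ e k → φ c e k)) ∎
  where
  open ≡-Reasoning
  Σsuc : ℤ
  Σsuc = conv n (λ c m → conv m (λ e k → φ c e (suc k)))

0S : PS
0S _ _ = 0ℤ

negS : PS → PS
negS f i j = - f i j

⊕-isAbelianGroup : IsAbelianGroup _≈S_ _⊕_ 0S negS
⊕-isAbelianGroup = Pointwise.isAbelianGroup ℕ (Pointwise.isAbelianGroup ℕ ℤP.+-0-isAbelianGroup)

⊛-cong : ∀ {f f′ g g′} → f ≈S f′ → g ≈S g′ → (f ⊛ g) ≈S (f′ ⊛ g′)
⊛-cong f≈f′ g≈g′ i j = sumTo-cong i (λ a → sumTo-cong j (λ b → cong₂ _*ℤ_ (f≈f′ a b) (g≈g′ _ _)))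

⊛-comm : ∀ f g → (f ⊛ g) ≈S (g ⊛ f)
⊛-comm f g i j = ≡.trans (conv-comm i (λ a a' → conv j (λ b b' → f a b *ℤ g a' b')))
  (conv-cong i (λ a a' → ≡.trans (conv-comm j (λ b b' → f a' b *ℤ g a b'))
                                 (conv-cong j (λ b b' → ℤP.*-comm (f a' b') (g a b)))))

-- Both sides are the sum of f c d · g c' d' · h a' b' over c + c' + a' = i
-- and d + d' + b' = j; the steps pull the scalar factors inside, exchange
-- the z- and t-summations and reassociate each convolution.
⊛-assoc : ∀ f g h → ((f ⊛ g) ⊛ h) ≈S (f ⊛ (g ⊛ h))
⊛-assoc f g h i j = begin
  conv i (λ a a' → conv j (λ b b' → conv a (λ c c' → conv b (λ d d' → f c d *ℤ g c' d')) *ℤ h a' b'))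
    ≡⟨ conv-cong i (λ a a' → conv-cong j (λ b b' → ≡.trans
         (sumTo-*ʳ a (h a' b') (λ c → conv b (λ d d' → f c d *ℤ g (a ∸ c) d')))
         (conv-cong a (λ c c' → sumTo-*ʳ b (h a' b') (λ d → f c d *ℤ g c' (b ∸ d)))))) ⟩
  conv i (λ a a' → conv j (λ b b' → conv a (λ c c' → conv b (λ d d' → f c d *ℤ g c' d' *ℤ h a' b'))))
    ≡⟨ conv-cong i (λ a a' → sumTo-swap j a (λ b c → conv b (λ d d' → f c d *ℤ g (a ∸ c) d' *ℤ h a' (j ∸ b)))) ⟩
  conv i (λ a a' → conv a (λ c c' → conv j (λ b b' → conv b (λ d d' → f c d *ℤ g c' d' *ℤ h a' b'))))
    ≡⟨ conv-cong i (λ a a' → conv-cong a (λ c c' → conv-assoc j (λ d d' b' → f c d *ℤ g c' d' *ℤ h a' b'))) ⟩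
  conv i (λ a a' → conv a (λ c c' → conv j (λ d m → conv m (λ d' b' → f c d *ℤ g c' d' *ℤ h a' b'))))
    ≡⟨ conv-assoc i (λ c c' a' → conv j (λ d m → conv m (λ d' b' → f c d *ℤ g c' d' *ℤ h a' b'))) ⟩
  conv i (λ c m → conv m (λ c' a' → conv j (λ d n → conv n (λ d' b' → f c d *ℤ g c' d' *ℤ h a' b'))))
    ≡⟨ conv-cong i (λ c m → conv-cong m (λ c' a' → conv-cong j (λ d n → conv-cong n (λ d' b' →
         ℤP.*-assoc (f c d) (g c' d') (h a' b'))))) ⟩
  conv i (λ c m → conv m (λ c' a' → conv j (λ d n → conv n (λ d' b' → f c d *ℤ (g c' d' *ℤ h a' b')))))
    ≡⟨ conv-cong i (λ c m → sumTo-swap m j (λ c' d → conv (j ∸ d) (λ d' b' → f c d *ℤ (g c' d' *ℤ h (m ∸ c') b')))) ⟩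
  conv i (λ c m → conv j (λ d n → conv m (λ c' a' → conv n (λ d' b' → f c d *ℤ (g c' d' *ℤ h a' b')))))
    ≡⟨ conv-cong i (λ c m → conv-cong j (λ d n → ≡.sym (≡.trans
         (sumTo-*ˡ m (f c d) (λ c' → conv n (λ d' b' → g c' d' *ℤ h (m ∸ c') b')))
         (conv-cong m (λ c' a' → sumTo-*ˡ n (f c d) (λ d' → g c' d' *ℤ h a' (n ∸ d'))))))) ⟩
  conv i (λ c m → conv j (λ d n → f c d *ℤ conv m (λ c' a' → conv n (λ d' b' → g c' d' *ℤ h a' b')))) ∎
  where open ≡-Reasoning

⊛-distribˡ : ∀ f g h → (f ⊛ (g ⊕ h)) ≈S ((f ⊛ g) ⊕ (f ⊛ h))
⊛-distribˡ f g h i j = ≡.trans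
  (conv-cong i (λ a a' → ≡.trans (conv-cong j (λ b b' → ℤP.*-distribˡ-+ (f a b) (g a' b') (h a' b')))
                                 (conv-+ j (λ b b' → f a b *ℤ g a' b') (λ b b' → f a b *ℤ h a' b'))))
  (conv-+ i (λ a a' → conv j (λ b b' → f a b *ℤ g a' b')) (λ a a' → conv j (λ b b' → f a b *ℤ h a' b')))

⊛-distribʳ : ∀ f g h → ((g ⊕ h) ⊛ f) ≈S ((g ⊛ f) ⊕ (h ⊛ f))
⊛-distribʳ f g h i j = ≡.trans (⊛-comm (g ⊕ h) f i j)
  (≡.trans (⊛-distribˡ f g h i j) (cong₂ _+ℤ_ (⊛-comm f g i j) (⊛-comm f h i j)))

concentrated-⊛ : ∀ (e f : PS) → (∀ a b → e (suc a) b ≡ 0ℤ) → (∀ b → e 0 (suc b) ≡ 0ℤ) →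
  ∀ i j → (e ⊛ f) i j ≡ e 0 0 *ℤ f i j
concentrated-⊛ e f e≡0 e₀≡0 i j = ≡.trans
  (sumTo-head i (λ a → sumTo-zero j (λ b _ → vanish (e≡0 a b))))
  (sumTo-head j (λ b → vanish (e₀≡0 b)))
  where
  vanish : ∀ {x y} → x ≡ 0ℤ → x *ℤ y ≡ 0ℤ
  vanish {y = y} ≡.refl = ℤP.*-zeroˡ y

⊛-identityˡ : ∀ f → (oneS ⊛ f) ≈S f
⊛-identityˡ f i j = ≡.trans (concentrated-⊛ oneS f (λ _ _ → ≡.refl) (λ _ → ≡.refl) i j) (ℤP.*-identityˡ (f i j))

PSring : CommutativeRing 0ℓ 0ℓ
PSring = record
  { Carrier = PS ; _≈_ = _≈S_ ; _+_ = _⊕_ ; _*_ = _⊛_ ; -_ = negS ; 0# = 0S ; 1# = oneS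
  ; isCommutativeRing = record
    { isRing = record
      { +-isAbelianGroup = ⊕-isAbelianGroup
      ; *-cong           = ⊛-cong
      ; *-assoc          = ⊛-assoc
      ; *-identity       = ⊛-identityˡ , (λ f i j → ≡.trans (⊛-comm f oneS i j) (⊛-identityˡ f i j))
      ; distrib          = ⊛-distribˡ , ⊛-distribʳ
      }
    ; *-comm = ⊛-comm
    }
  }

constant : ℤ → PS
constant c zero zero = c
constant c _    _    = 0ℤ

fromℤ : ℤ-rawRing -Raw-AlmostCommutative⟶ fromCommutativeRing PSring
fromℤ = record
  { ⟦_⟧    = constant
  ; +-homo = λ a b → λ { zero zero → ≡.refl ; zero (suc _) → ≡.refl ; (suc _) _ → ≡.refl }
  ; *-homo = λ a b i j → ≡.sym (≡.trans (concentrated-⊛ (constant a) (constant b) (λ _ _ → ≡.refl) (λ _ → ≡.refl) i j)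
                                        (scale a b i j))
  ; -‿homo = λ a → λ { zero zero → ≡.refl ; zero (suc _) → ≡.refl ; (suc _) _ → ≡.refl }
  ; 0-homo = λ { zero zero → ≡.refl ; zero (suc _) → ≡.refl ; (suc _) _ → ≡.refl }
  ; 1-homo = λ { zero zero → ≡.refl ; zero (suc _) → ≡.refl ; (suc _) _ → ≡.refl }
  }
  where
  scale : ∀ a b i j → a *ℤ constant b i j ≡ constant (a *ℤ b) i j
  scale a b zero    zero    = ≡.refl
  scale a b zero    (suc j) = ℤP.*-zeroʳ a
  scale a b (suc i) j       = ℤP.*-zeroʳ a

-- Part 3: the geometric series 1/(1-h).

degree-drops-z : ∀ {i a} j b → suc a ≤ i → b ≤ j → (i ∸ suc a) +ℕ (j ∸ b) < i +ℕ j
degree-drops-z {suc i} {a} j b (s≤s a≤i) b≤j = s≤s (ℕP.+-mono-≤ (ℕP.m∸n≤m i a) (ℕP.m∸n≤m j b))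

degree-drops-t : ∀ i {j b} → suc b ≤ j → (i ∸ 0) +ℕ (j ∸ suc b) < i +ℕ j
degree-drops-t i {suc j} {b} (s≤s b≤j) = ℕP.+-monoʳ-< i (s≤s (ℕP.m∸n≤m j b))

powers-vanish : ∀ (h : PS) → h 0 0 ≡ 0ℤ → ∀ k i j → i +ℕ j < k → (h ^S k) i j ≡ 0ℤ
powers-vanish h h₀₀≡0 (suc k) i j i+j<1+k =
  sumTo-zero i (λ a a≤i → sumTo-zero j (λ b b≤j → term a b a≤i b≤j))
  where
  lower : ∀ {a b} → (i ∸ a) +ℕ (j ∸ b) < i +ℕ j → h a b *ℤ (h ^S k) (i ∸ a) (j ∸ b) ≡ 0ℤ
  lower {a} {b} lt = ≡.trans (cong (h a b *ℤ_) (powers-vanish h h₀₀≡0 k _ _ (ℕP.<-≤-trans lt (ℕP.≤-pred i+j<1+k))))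
                             (ℤP.*-zeroʳ (h a b))
  term : ∀ a b → a ≤ i → b ≤ j → h a b *ℤ (h ^S k) (i ∸ a) (j ∸ b) ≡ 0ℤ
  term zero    zero    _   _   = ≡.trans (cong (_*ℤ (h ^S k) i j) h₀₀≡0) (ℤP.*-zeroˡ ((h ^S k) i j))
  term zero    (suc b) _   b≤j = lower (degree-drops-t i b≤j)
  term (suc a) b       a≤i b≤j = lower (degree-drops-z j b a≤i b≤j)

inv1m-truncation : ∀ (h : PS) → h 0 0 ≡ 0ℤ → ∀ i j N → i +ℕ j ≤ N →
  sumTo N (λ k → (h ^S k) i j) ≡ inv1m h i j
inv1m-truncation h h₀₀≡0 i j N i+j≤N =
  sumTo-extend (i +ℕ j) N i+j≤N (λ k i+j<k _ → powers-vanish h h₀₀≡0 k i j i+j<k)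

-- 1/(1-h) = 1 + h · 1/(1-h): coefficientwise, both sides are Σ_{k ≤ N} h^k
-- with N = i + j + 1.
inv1m-fixedPoint : ∀ (h : PS) → h 0 0 ≡ 0ℤ → inv1m h ≈S (oneS ⊕ h ⊛ inv1m h)
inv1m-fixedPoint h h₀₀≡0 i j = ≡.sym (begin
  oneS i j +ℤ (h ⊛ inv1m h) i j
    ≡⟨ cong (oneS i j +ℤ_) (sumTo-cong i (λ a → sumTo-cong j (λ b → ≡.trans
         (cong (h a b *ℤ_) (≡.sym (inv1m-truncation h h₀₀≡0 (i ∸ a) (j ∸ b) N
                                    (ℕP.+-mono-≤ (ℕP.m∸n≤m i a) (ℕP.m∸n≤m j b)))))
         (sumTo-*ˡ N (h a b) (λ k → (h ^S k) (i ∸ a) (j ∸ b)))))) ⟩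
  oneS i j +ℤ sumTo i (λ a → sumTo j (λ b → sumTo N (λ k → h a b *ℤ (h ^S k) (i ∸ a) (j ∸ b))))
    ≡⟨ cong (oneS i j +ℤ_) (≡.trans
         (sumTo-cong i (λ a → sumTo-swap j N (λ b k → h a b *ℤ (h ^S k) (i ∸ a) (j ∸ b))))
         (sumTo-swap i N (λ a k → sumTo j (λ b → h a b *ℤ (h ^S k) (i ∸ a) (j ∸ b))))) ⟩
  oneS i j +ℤ sumTo N (λ k → (h ^S suc k) i j)
    ≡⟨ ≡.sym (sumTo-shift N (λ k → (h ^S k) i j)) ⟩
  sumTo (suc N) (λ k → (h ^S k) i j)
    ≡⟨ inv1m-truncation h h₀₀≡0 i j (suc N) (ℕP.n≤1+n N) ⟩
  inv1m h i j ∎)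
  where
  open ≡-Reasoning
  N : ℕ
  N = i +ℕ j

-- The substitution identity in the ring of power series with q = T², for
-- the geometric series A = 1/(1-t), C = 1/(1-t-T²), B = 1/(1-u-T²); their
-- ratios t, t + T², u + T² have no constant term.
mainTheorem3 : (inv1m tS ⊛ SS (tS ⊛ (TS ⊛ TS) ⊛ inv1m tS)) ≈S SS tS
mainTheorem3 =
  substitutionIdentity {z = zS} {t = tS} {q = T²} {A = A} {B = B} {C = C}
    (inv1m-fixedPoint tS ≡.refl)
    (inv1m-fixedPoint (tS ⊕ T²) ≡.refl)
    (inv1m-fixedPoint (u ⊕ T²) ≡.refl)
  where
  open SubstitutionIdentity PSring fromℤ
  T² A u B C : PS
  T² = TS ⊛ TS
  A  = inv1m tS
  u  = tS ⊛ T² ⊛ A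
  B  = inv1m (u ⊕ T²)
  C  = inv1m (tS ⊕ T²)
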